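{- The algebra $\mathcal{U}/I_{\mathrm{Lam}}^{\mathrm{st},k}$ is a quotient of $\mathcal{U}/I_{\mathrm{Assaf}}^{\mathrm{st},k}$, i.e. $I_{\mathrm{Assaf}}^{\mathrm{st},k}\subseteq I_{\mathrm{Lam}}^{\mathrm{st},k}$.
   Context: $\mathcal{U}=\mathbb{Z}\langle u_1,\dots,u_N\rangle$ (letter $a$ = $u_a$), viewed inside $\mathcal{U}_q=\mathbb{Q}(q)\otimes_{\mathbb{Z}}\mathcal{U}$. $J_{\mathrm{Lam}}^{\mathrm{st},k}$ is the two-sided ideal of $\mathcal{U}_q$ generated by $ac-ca$ for $c-a>k$, $ab-q^{ -1}ba$ for $0<b-a<k$, and all words with a repeated letter; $I_{\mathrm{Lam}}^{\mathrm{st},k}=\mathcal{U}\cap J_{\mathrm{Lam}}^{\mathrm{st},k}$. $I_{\mathrm{Assaf}}^{\mathrm{st},k}$ is the two-sided ideal of $\mathcal{U}$ generated by, for letters $a<b<c$: $bac-bca$ and $acb-cab$ when $c-a>k$; $bac-acb$ and $bca-cab$ when $c-a\le k$; together with all words with a repeated letter. -}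

module Defs where

open import Level using (0ℓ)
open import Data.Nat as ℕ using (ℕ; zero; suc; _<_; _≤_)
open import Data.Fin using (Fin; toℕ)
import Data.Fin.Properties as FinP
open import Data.Integer as ℤ using (ℤ)
open import Data.Rational as ℚ using (ℚ; 0ℚ; 1ℚ)
import Data.Rational.Properties as ℚP
open import Data.List using (List; []; _∷_; _++_; map; concatMap; [_])
open import Data.List.Properties using (≡-dec)
open import Data.List.Relation.Unary.Any using (Any; here; there; any?)
open import Data.List.Relation.Unary.Unique.Propositional using (Unique)
open import Data.Product using (_×_; _,_)
open import Relation.Nullary using (¬_; yes; no; ¬?)
open import Relation.Binary.PropositionalEquality using (_≡_; _≢_)
open import Algebra.Bundles.Raw using (RawRing)

-- Polynomials in q over ℚ: coefficient lists, lowest degree first.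
QPoly : Set
QPoly = List ℚ

pcoef : ℕ → QPoly → ℚ
pcoef _       []      = 0ℚ
pcoef zero    (c ∷ _) = c
pcoef (suc n) (_ ∷ p) = pcoef n p

_+P_ : QPoly → QPoly → QPoly
[]      +P r       = r
(a ∷ p) +P []      = a ∷ p
(a ∷ p) +P (b ∷ r) = (a ℚ.+ b) ∷ (p +P r)

scaleP : ℚ → QPoly → QPoly
scaleP c p = map (c ℚ.*_) p

_*P_ : QPoly → QPoly → QPoly
[]      *P r = []
(a ∷ p) *P r = scaleP a r +P (0ℚ ∷ (p *P r))

_≈P_ : QPoly → QPoly → Set
p ≈P r = ∀ n → pcoef n p ≡ pcoef n r

NonZeroP : QPoly → Set
NonZeroP p = Any (λ c → c ≢ 0ℚ) p

record ℚ⟮q⟯ : Set where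
  field
    num   : QPoly
    den   : QPoly
    den≢0 : NonZeroP den
open ℚ⟮q⟯ public

1≢0 : 1ℚ ≢ 0ℚ
1≢0 ()

0F : ℚ⟮q⟯
0F = record { num = [] ; den = 1ℚ ∷ [] ; den≢0 = here 1≢0 }

1F : ℚ⟮q⟯
1F = record { num = 1ℚ ∷ [] ; den = 1ℚ ∷ [] ; den≢0 = here 1≢0 }

qF : ℚ⟮q⟯
qF = record { num = 0ℚ ∷ 1ℚ ∷ [] ; den = 1ℚ ∷ [] ; den≢0 = here 1≢0 }

q⁻¹F : ℚ⟮q⟯
q⁻¹F = record { num = 1ℚ ∷ [] ; den = 0ℚ ∷ 1ℚ ∷ [] ; den≢0 = there (here 1≢0) }

-- The denominators passed below are products of
-- nonzero polynomials, hence nonzero (ℚ[q] is a domain); the fallback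
-- branch is never reached and only avoids proving that fact here.
mkFrac : QPoly → QPoly → ℚ⟮q⟯
mkFrac n d with any? (λ c → ¬? (c ℚP.≟ 0ℚ)) d
... | yes nz = record { num = n ; den = d ; den≢0 = nz }
... | no  _  = 0F

_+F_ : ℚ⟮q⟯ → ℚ⟮q⟯ → ℚ⟮q⟯
x +F y = mkFrac ((num x *P den y) +P (num y *P den x)) (den x *P den y)

_*F_ : ℚ⟮q⟯ → ℚ⟮q⟯ → ℚ⟮q⟯
x *F y = mkFrac (num x *P num y) (den x *P den y)

-F_ : ℚ⟮q⟯ → ℚ⟮q⟯
-F x = record { num = scaleP (ℚ.- 1ℚ) (num x) ; den = den x ; den≢0 = den≢0 x }

_≈F_ : ℚ⟮q⟯ → ℚ⟮q⟯ → Set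
x ≈F y = (num x *P den y) ≈P (num y *P den x)

ℚ⟮q⟯-rawRing : RawRing 0ℓ 0ℓ
ℚ⟮q⟯-rawRing = record
  { Carrier = ℚ⟮q⟯ ; _≈_ = _≈F_ ; _+_ = _+F_ ; _*_ = _*F_ ; -_ = -F_
  ; 0# = 0F ; 1# = 1F }

ℤ→ℚ⟮q⟯ : ℤ → ℚ⟮q⟯
ℤ→ℚ⟮q⟯ z = record { num = (z ℚ./ 1) ∷ [] ; den = 1ℚ ∷ [] ; den≢0 = here 1≢0 }

-- Free associative algebra R⟨u₁,…,u_N⟩ over a coefficient ring R.
-- Letter a (a = 1..N) is represented by an element of Fin N (order preserved).

Word : ℕ → Set
Word N = List (Fin N)

NCPoly : RawRing 0ℓ 0ℓ → ℕ → Set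
NCPoly R N = List (RawRing.Carrier R × Word N)

module _ (R : RawRing 0ℓ 0ℓ) {N : ℕ} where
  open RawRing R

  coeff : NCPoly R N → Word N → Carrier
  coeff []            w = 0#
  coeff ((c , v) ∷ f) w with ≡-dec FinP._≟_ v w
  ... | yes _ = c + coeff f w
  ... | no  _ = coeff f w

  _≈NC_ : NCPoly R N → NCPoly R N → Set
  f ≈NC g = ∀ w → coeff f w ≈ coeff g w

  addNC : NCPoly R N → NCPoly R N → NCPoly R N
  addNC f g = f ++ g

  mulNC : NCPoly R N → NCPoly R N → NCPoly R N
  mulNC f g = concatMap (λ { (c , v) → map (λ { (d , u) → (c * d , v ++ u) }) g }) f

  negNC : NCPoly R N → NCPoly R N
  negNC f = map (λ { (c , v) → (- c , v) }) f

  subNC : NCPoly R N → NCPoly R N → NCPoly R N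
  subNC f g = addNC f (negNC g)

  wordNC : Word N → NCPoly R N
  wordNC w = [ (1# , w) ]

  data Ideal (S : NCPoly R N → Set) : NCPoly R N → Set where
    gen   : ∀ {f} → S f → Ideal S f
    zero  : Ideal S []
    add   : ∀ {f g} → Ideal S f → Ideal S g → Ideal S (addNC f g)
    mulˡ  : ∀ {f} (h : NCPoly R N) → Ideal S f → Ideal S (mulNC h f)
    mulʳ  : ∀ {f} → Ideal S f → (h : NCPoly R N) → Ideal S (mulNC f h)
    resp  : ∀ {f g} → f ≈NC g → Ideal S f → Ideal S g

-- 𝒰 = ℤ⟨u₁,…,u_N⟩ and 𝒰_q = ℚ(q) ⊗ 𝒰 = ℚ(q)⟨u₁,…,u_N⟩
𝒰 : ℕ → Set
𝒰 N = NCPoly ℤ.+-*-rawRing N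

𝒰q : ℕ → Set
𝒰q N = NCPoly ℚ⟮q⟯-rawRing N

embed : ∀ {N} → 𝒰 N → 𝒰q N
embed f = map (λ { (c , w) → (ℤ→ℚ⟮q⟯ c , w) }) f

data LamGen (N k : ℕ) : 𝒰q N → Set where
  far  : (a c : Fin N) → toℕ a ℕ.+ k < toℕ c →
         LamGen N k (subNC ℚ⟮q⟯-rawRing (wordNC ℚ⟮q⟯-rawRing (a ∷ c ∷ []))
                                        (wordNC ℚ⟮q⟯-rawRing (c ∷ a ∷ [])))
  near : (a b : Fin N) → toℕ a < toℕ b → toℕ b < toℕ a ℕ.+ k →
         LamGen N k ((1F , a ∷ b ∷ []) ∷ (-F q⁻¹F , b ∷ a ∷ []) ∷ [])
  rep  : (w : Word N) → ¬ Unique w → LamGen N k (wordNC ℚ⟮q⟯-rawRing w)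

J-Lam : (N k : ℕ) → 𝒰q N → Set
J-Lam N k = Ideal ℚ⟮q⟯-rawRing (LamGen N k)

-- I_Lam^{st,k} = 𝒰 ∩ J_Lam^{st,k}
I-Lam : (N k : ℕ) → 𝒰 N → Set
I-Lam N k f = J-Lam N k (embed f)

private
  w3 : ∀ {N} → Fin N → Fin N → Fin N → 𝒰 N
  w3 x y z = wordNC ℤ.+-*-rawRing (x ∷ y ∷ z ∷ [])

  _-𝒰_ : ∀ {N} → 𝒰 N → 𝒰 N → 𝒰 N
  f -𝒰 g = subNC ℤ.+-*-rawRing f g

data AssafGen (N k : ℕ) : 𝒰 N → Set where
  far₁  : (a b c : Fin N) → toℕ a < toℕ b → toℕ b < toℕ c → toℕ a ℕ.+ k < toℕ c →
          AssafGen N k (w3 b a c -𝒰 w3 b c a)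
  far₂  : (a b c : Fin N) → toℕ a < toℕ b → toℕ b < toℕ c → toℕ a ℕ.+ k < toℕ c →
          AssafGen N k (w3 a c b -𝒰 w3 c a b)
  near₁ : (a b c : Fin N) → toℕ a < toℕ b → toℕ b < toℕ c → toℕ c ≤ toℕ a ℕ.+ k →
          AssafGen N k (w3 b a c -𝒰 w3 a c b)
  near₂ : (a b c : Fin N) → toℕ a < toℕ b → toℕ b < toℕ c → toℕ c ≤ toℕ a ℕ.+ k →
          AssafGen N k (w3 b c a -𝒰 w3 c a b)
  rep   : (w : Word N) → ¬ Unique w → AssafGen N k (wordNC ℤ.+-*-rawRing w)

I-Assaf : (N k : ℕ) → 𝒰 N → Set
I-Assaf N k = Ideal ℤ.+-*-rawRing (AssafGen N k)

-- Each Assaf generator lies in J_Lam: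
--   bac − bca = b (ac − ca),  acb − cab = (ac − ca) b     when c − a > k,
--   bac − acb = −q (ab − q⁻¹ba) c + q a (bc − q⁻¹cb),
--   bca − cab = (bc − q⁻¹cb) a − c (ab − q⁻¹ba)          when c − a ≤ k,
-- as c − a ≤ k forces b − a < k and c − b < k; words with a repeated letter
-- generate both ideals.  The inclusion 𝒰 ↪ 𝒰_q respects sums, products and
-- equality of coefficients, so it carries all of I_Assaf into J_Lam.  Since
-- ℚ(q) is only a raw ring, multiplicativity is checked on coefficients: those
-- of elements of 𝒰 are fractions a/1 with a ∈ ℚ, compared through their value a.
module Submission where

open import Level using (0ℓ)
open import Function using (_∘_; Equivalence)
open import Data.Nat as ℕ using (ℕ; zero; suc; _<_; _≤_)
import Data.Nat.Properties as ℕP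
open import Data.Fin using (Fin; toℕ)
import Data.Fin.Properties as FinP
open import Data.Integer as ℤ using (ℤ)
import Data.Integer.Properties as ℤP
open import Data.Rational as ℚ using (ℚ; 0ℚ; 1ℚ; toℚᵘ; fromℚᵘ)
import Data.Rational.Properties as ℚP
import Data.Rational.Unnormalised as ℚᵘ
import Data.Rational.Unnormalised.Properties as ℚᵘP
open import Data.Bool using (Bool; true; false; T; _∧_)
open import Data.Bool.Properties using (T-∧)
open import Data.Unit using (tt)
open import Data.Product using (_×_; _,_; proj₁; proj₂)
open import Data.List using (List; []; _∷_; [_])
open import Data.List.Properties using (≡-dec; map-++; ∷-injectiveˡ; ∷-injectiveʳ)
open import Data.List.Relation.Unary.Any using (here; any?)
open import Data.List.Relation.Binary.Pointwise as Pointwise using (Pointwise; []; _∷_)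
open import Relation.Nullary using (¬?; yes; no)
open import Relation.Nullary.Decidable using (⌊_⌋; toWitness)
open import Relation.Nullary.Negation using (contradiction)
open import Relation.Nullary.Reflects using (Reflects; ofʸ; ofⁿ)
open import Relation.Binary.PropositionalEquality
  using (_≡_; _≢_; refl; sym; trans; cong; cong₂; subst; subst₂)
open import Algebra.Bundles.Raw using (RawRing)
open import Defs

ℚ⟮q⟯ʳ : RawRing 0ℓ 0ℓ
ℚ⟮q⟯ʳ = ℚ⟮q⟯-rawRing

ℤʳ : RawRing 0ℓ 0ℓ
ℤʳ = ℤ.+-*-rawRing

pcoef-+P : ∀ n p r → pcoef n (p +P r) ≡ pcoef n p ℚ.+ pcoef n r
pcoef-+P n       []      r       = sym (ℚP.+-identityˡ _)
pcoef-+P n       (a ∷ p) []      = sym (ℚP.+-identityʳ _)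
pcoef-+P zero    (a ∷ p) (b ∷ r) = refl
pcoef-+P (suc n) (a ∷ p) (b ∷ r) = pcoef-+P n p r

pcoef-scaleP : ∀ n c p → pcoef n (scaleP c p) ≡ c ℚ.* pcoef n p
pcoef-scaleP n       c []      = sym (ℚP.*-zeroʳ c)
pcoef-scaleP zero    c (a ∷ p) = refl
pcoef-scaleP (suc n) c (a ∷ p) = pcoef-scaleP n c p

IsConstPoly : ℚ → QPoly → Set
IsConstPoly a p = p ≈P [ a ]

pcoef-[0] : ∀ n → pcoef n [ 0ℚ ] ≡ 0ℚ
pcoef-[0] zero    = refl
pcoef-[0] (suc n) = refl

*P-isConstPoly : ∀ {a b} p r → IsConstPoly a p → IsConstPoly b r → IsConstPoly (a ℚ.* b) (p *P r)
*P-isConstPoly {a} {b} []      r p≈a r≈b zero    = trans (sym (ℚP.*-zeroˡ b)) (cong (ℚ._* b) (p≈a 0))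
*P-isConstPoly         []      r p≈a r≈b (suc n) = refl
*P-isConstPoly {a} {b} (x ∷ p) r p≈a r≈b n       = begin
  pcoef n (scaleP x r +P (0ℚ ∷ (p *P r)))          ≡⟨ pcoef-+P n (scaleP x r) _ ⟩
  pcoef n (scaleP x r) ℚ.+ pcoef n (0ℚ ∷ (p *P r)) ≡⟨ cong (ℚ._+ _) (pcoef-scaleP n x r) ⟩
  x ℚ.* pcoef n r ℚ.+ pcoef n (0ℚ ∷ (p *P r))      ≡⟨ coefficients n ⟩
  pcoef n [ a ℚ.* b ]                              ∎
  where
  open Relation.Binary.PropositionalEquality.≡-Reasoning
  p≈0 : IsConstPoly 0ℚ p
  p≈0 n = trans (p≈a (suc n)) (sym (pcoef-[0] n))
  coefficients : ∀ n → x ℚ.* pcoef n r ℚ.+ pcoef n (0ℚ ∷ (p *P r)) ≡ pcoef n [ a ℚ.* b ]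
  coefficients zero    = trans (ℚP.+-identityʳ _) (cong₂ ℚ._*_ (p≈a 0) (r≈b 0))
  coefficients (suc n) = begin
    x ℚ.* pcoef (suc n) r ℚ.+ pcoef n (p *P r) ≡⟨ cong₂ ℚ._+_ (cong (x ℚ.*_) (r≈b (suc n)))
                                                             (*P-isConstPoly p r p≈0 r≈b n) ⟩
    x ℚ.* 0ℚ ℚ.+ pcoef n [ 0ℚ ℚ.* b ]          ≡⟨ cong₂ ℚ._+_ (ℚP.*-zeroʳ x)
                                                             (cong (λ c → pcoef n [ c ]) (ℚP.*-zeroˡ b)) ⟩
    0ℚ ℚ.+ pcoef n [ 0ℚ ]                      ≡⟨ cong (0ℚ ℚ.+_) (pcoef-[0] n) ⟩
    0ℚ ℚ.+ 0ℚ                                  ≡⟨ ℚP.+-identityˡ 0ℚ ⟩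
    pcoef (suc n) [ a ℚ.* b ]                  ∎

record IsConstant (a : ℚ) (x : ℚ⟮q⟯) : Set where
  field
    num-const : IsConstPoly a (num x)
    den-const : IsConstPoly 1ℚ (den x)
open IsConstant

isConstant⇒≈F : ∀ {a x y} → IsConstant a x → IsConstant a y → x ≈F y
isConstant⇒≈F {x = x} {y} x≈a y≈a n =
  trans (*P-isConstPoly (num x) (den y) (num-const x≈a) (den-const y≈a) n)
        (sym (*P-isConstPoly (num y) (den x) (num-const y≈a) (den-const x≈a) n))

mkFrac-isConstant : ∀ {a} n d → IsConstPoly a n → IsConstPoly 1ℚ d → IsConstant a (mkFrac n d)
mkFrac-isConstant n d n≈a d≈1 with any? (λ c → ¬? (c ℚP.≟ 0ℚ)) d
... | yes _     = record { num-const = n≈a ; den-const = d≈1 }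
... | no  d≡0 = contradiction (nonzero-head d (1≢0 ∘ trans (sym (d≈1 0)))) d≡0
  where
  nonzero-head : ∀ d → pcoef 0 d ≢ 0ℚ → NonZeroP d
  nonzero-head []      d₀≢0 = contradiction refl d₀≢0
  nonzero-head (c ∷ d) d₀≢0 = here d₀≢0

*P-den-isConstPoly : ∀ {x y a b} → IsConstant a x → IsConstant b y → IsConstPoly 1ℚ (den x *P den y)
*P-den-isConstPoly {x} {y} x≈a y≈b n =
  trans (*P-isConstPoly (den x) (den y) (den-const x≈a) (den-const y≈b) n)
        (cong (λ c → pcoef n [ c ]) (ℚP.*-identityʳ 1ℚ))

+F-isConstant : ∀ {a b x y} → IsConstant a x → IsConstant b y → IsConstant (a ℚ.+ b) (x +F y)
+F-isConstant {a} {b} {x} {y} x≈a y≈b =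
  mkFrac-isConstant ((num x *P den y) +P (num y *P den x)) (den x *P den y)
    numerator (*P-den-isConstPoly x≈a y≈b)
  where
  numerator : IsConstPoly (a ℚ.+ b) ((num x *P den y) +P (num y *P den x))
  numerator n = begin
    pcoef n ((num x *P den y) +P (num y *P den x))           ≡⟨ pcoef-+P n (num x *P den y) _ ⟩
    pcoef n (num x *P den y) ℚ.+ pcoef n (num y *P den x)    ≡⟨ cong₂ ℚ._+_
      (*P-isConstPoly (num x) (den y) (num-const x≈a) (den-const y≈b) n)
      (*P-isConstPoly (num y) (den x) (num-const y≈b) (den-const x≈a) n) ⟩
    pcoef n [ a ℚ.* 1ℚ ] ℚ.+ pcoef n [ b ℚ.* 1ℚ ]            ≡⟨ sum-of-constants n ⟩
    pcoef n [ a ℚ.+ b ]                                      ∎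
    where
    open Relation.Binary.PropositionalEquality.≡-Reasoning
    sum-of-constants : ∀ n → pcoef n [ a ℚ.* 1ℚ ] ℚ.+ pcoef n [ b ℚ.* 1ℚ ] ≡ pcoef n [ a ℚ.+ b ]
    sum-of-constants zero    = cong₂ ℚ._+_ (ℚP.*-identityʳ a) (ℚP.*-identityʳ b)
    sum-of-constants (suc n) = ℚP.+-identityˡ 0ℚ

*F-isConstant : ∀ {a b x y} → IsConstant a x → IsConstant b y → IsConstant (a ℚ.* b) (x *F y)
*F-isConstant {x = x} {y} x≈a y≈b =
  mkFrac-isConstant (num x *P num y) (den x *P den y)
    (*P-isConstPoly (num x) (num y) (num-const x≈a) (num-const y≈b)) (*P-den-isConstPoly x≈a y≈b)

fromℚᵘ-homo-+ : ∀ p q → fromℚᵘ (p ℚᵘ.+ q) ≡ fromℚᵘ p ℚ.+ fromℚᵘ q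
fromℚᵘ-homo-+ p q = ℚP.toℚᵘ-injective (begin
  toℚᵘ (fromℚᵘ (p ℚᵘ.+ q))                ≈⟨ ℚP.toℚᵘ-fromℚᵘ (p ℚᵘ.+ q) ⟩
  p ℚᵘ.+ q                                ≈⟨ ℚᵘP.+-cong (ℚP.toℚᵘ-fromℚᵘ p) (ℚP.toℚᵘ-fromℚᵘ q) ⟨
  toℚᵘ (fromℚᵘ p) ℚᵘ.+ toℚᵘ (fromℚᵘ q)  ≈⟨ ℚP.toℚᵘ-homo-+ (fromℚᵘ p) (fromℚᵘ q) ⟨
  toℚᵘ (fromℚᵘ p ℚ.+ fromℚᵘ q)           ∎)
  where open ℚᵘP.≃-Reasoning

fromℚᵘ-homo-* : ∀ p q → fromℚᵘ (p ℚᵘ.* q) ≡ fromℚᵘ p ℚ.* fromℚᵘ q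
fromℚᵘ-homo-* p q = ℚP.toℚᵘ-injective (begin
  toℚᵘ (fromℚᵘ (p ℚᵘ.* q))                ≈⟨ ℚP.toℚᵘ-fromℚᵘ (p ℚᵘ.* q) ⟩
  p ℚᵘ.* q                                ≈⟨ ℚᵘP.*-cong (ℚP.toℚᵘ-fromℚᵘ p) (ℚP.toℚᵘ-fromℚᵘ q) ⟨
  toℚᵘ (fromℚᵘ p) ℚᵘ.* toℚᵘ (fromℚᵘ q)  ≈⟨ ℚP.toℚᵘ-homo-* (fromℚᵘ p) (fromℚᵘ q) ⟨
  toℚᵘ (fromℚᵘ p ℚ.* fromℚᵘ q)           ∎)
  where open ℚᵘP.≃-Reasoning

ι : ℤ → ℚ
ι z = fromℚᵘ (z ℚᵘ./ 1)

ι-+ : ∀ a b → ι (a ℤ.+ b) ≡ ι a ℚ.+ ι b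
ι-+ a b = trans (ℚP.fromℚᵘ-cong {(a ℤ.+ b) ℚᵘ./ 1} {a ℚᵘ./ 1 ℚᵘ.+ b ℚᵘ./ 1}
                                (ℚᵘ.*≡* (cong (ℤ._* ℤ.+ 1) a+b≡a1+b1)))
                (fromℚᵘ-homo-+ (a ℚᵘ./ 1) (b ℚᵘ./ 1))
  where
  a+b≡a1+b1 : a ℤ.+ b ≡ a ℤ.* ℤ.+ 1 ℤ.+ b ℤ.* ℤ.+ 1
  a+b≡a1+b1 = sym (cong₂ ℤ._+_ (ℤP.*-identityʳ a) (ℤP.*-identityʳ b))

ι-* : ∀ a b → ι (a ℤ.* b) ≡ ι a ℚ.* ι b
ι-* a b = trans (ℚP.fromℚᵘ-cong {(a ℤ.* b) ℚᵘ./ 1} {(a ℚᵘ./ 1) ℚᵘ.* (b ℚᵘ./ 1)} (ℚᵘ.*≡* refl))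
                (fromℚᵘ-homo-* (a ℚᵘ./ 1) (b ℚᵘ./ 1))

ℤ→ℚ⟮q⟯-isConstant : ∀ z → IsConstant (ι z) (ℤ→ℚ⟮q⟯ z)
ℤ→ℚ⟮q⟯-isConstant z = record { num-const = λ _ → refl ; den-const = λ _ → refl }

0F-isConstant : IsConstant (ι (ℤ.+ 0)) 0F
0F-isConstant = record { num-const = sym ∘ pcoef-[0] ; den-const = λ _ → refl }

module _ (R : RawRing 0ℓ 0ℓ) {N : ℕ} where
  open RawRing R

  selectedCoeff : List Bool → NCPoly R N → Carrier
  selectedCoeff (true  ∷ bs) ((c , _) ∷ F) = c + selectedCoeff bs F
  selectedCoeff (false ∷ bs) (_ ∷ F)       = selectedCoeff bs F
  selectedCoeff _            _             = 0#

  Matches : Word N → List Bool → NCPoly R N → Set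
  Matches w = Pointwise (λ b t → Reflects (proj₂ t ≡ w) b)

  coeff-matches : ∀ {w bs F} → Matches w bs F → coeff R F w ≡ selectedCoeff bs F
  coeff-matches [] = refl
  coeff-matches {w} (_∷_ {y = c , v} v≡w? m) with ≡-dec FinP._≟_ v w | v≡w?
  ... | yes _   | ofʸ _   = cong (c +_) (coeff-matches m)
  ... | yes v≡w | ofⁿ v≢w = contradiction v≡w v≢w
  ... | no  v≢w | ofʸ v≡w = contradiction v≡w v≢w
  ... | no  _   | ofⁿ _   = coeff-matches m

data TermLift {N : ℕ} : ℚ⟮q⟯ × Word N → ℤ × Word N → Set where
  lift : ∀ {C c v} → IsConstant (ι c) C → TermLift (C , v) (c , v)

Lift : ∀ {N} → 𝒰q N → 𝒰 N → Set
Lift = Pointwise TermLift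

coeff-lift : ∀ {N} {F : 𝒰q N} {f : 𝒰 N} → Lift F f → ∀ w → IsConstant (ι (coeff ℤʳ f w)) (coeff ℚ⟮q⟯ʳ F w)
coeff-lift []                       w = 0F-isConstant
coeff-lift (lift {c = c} {v} C≈c ∷ F≈f) w with ≡-dec FinP._≟_ v w
... | yes _ = subst (λ a → IsConstant a _) (sym (ι-+ c _)) (+F-isConstant C≈c (coeff-lift F≈f w))
... | no  _ = coeff-lift F≈f w

lift⇒≈NC : ∀ {N} {F G : 𝒰q N} {f : 𝒰 N} → Lift F f → Lift G f → _≈NC_ ℚ⟮q⟯ʳ F G
lift⇒≈NC F≈f G≈f w = isConstant⇒≈F (coeff-lift F≈f w) (coeff-lift G≈f w)

embed-lift : ∀ {N} (f : 𝒰 N) → Lift (embed f) f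
embed-lift []            = []
embed-lift ((c , v) ∷ f) = lift (ℤ→ℚ⟮q⟯-isConstant c) ∷ embed-lift f

mulNC-lift : ∀ {N} {F G : 𝒰q N} {f g : 𝒰 N} → Lift F f → Lift G g → Lift (mulNC ℚ⟮q⟯ʳ F G) (mulNC ℤʳ f g)
mulNC-lift F≈f G≈g = Pointwise.concat⁺ (Pointwise.map⁺ _ _ (Pointwise.map multiply-term F≈f))
  where
  multiply-term : ∀ {X x} → TermLift X x → Pointwise _ _ _
  multiply-term (lift {c = c} C≈c) = Pointwise.map⁺ _ _ (Pointwise.map
    (λ { (lift {c = d} D≈d) → lift (subst (λ a → IsConstant a _) (sym (ι-* c d)) (*F-isConstant C≈c D≈d)) })
    G≈g)

embed-cong : ∀ {N} {f g : 𝒰 N} → _≈NC_ ℤʳ f g → _≈NC_ ℚ⟮q⟯ʳ (embed f) (embed g)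
embed-cong {f = f} {g} f≈g w = isConstant⇒≈F
  (subst (λ z → IsConstant (ι z) (coeff ℚ⟮q⟯ʳ (embed f) w)) (f≈g w) (coeff-lift (embed-lift f) w))
  (coeff-lift (embed-lift g) w)

embed-mulNC : ∀ {N} (f g : 𝒰 N) → _≈NC_ ℚ⟮q⟯ʳ (mulNC ℚ⟮q⟯ʳ (embed f) (embed g)) (embed (mulNC ℤʳ f g))
embed-mulNC f g = lift⇒≈NC (mulNC-lift (embed-lift f) (embed-lift g)) (embed-lift (mulNC ℤʳ f g))

embed-ideal : ∀ {N} {S : 𝒰 N → Set} {T : 𝒰q N → Set} →
              (∀ {g} → S g → Ideal ℚ⟮q⟯ʳ T (embed g)) →
              ∀ {f} → Ideal ℤʳ S f → Ideal ℚ⟮q⟯ʳ T (embed f)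
embed-ideal S⊆T (gen s)          = S⊆T s
embed-ideal S⊆T zero             = zero
embed-ideal S⊆T (add {f} {g} p q) =
  subst (Ideal ℚ⟮q⟯ʳ _) (sym (map-++ _ f g)) (add (embed-ideal S⊆T p) (embed-ideal S⊆T q))
embed-ideal S⊆T (mulˡ {f} h p)   = resp (embed-mulNC h f) (mulˡ (embed h) (embed-ideal S⊆T p))
embed-ideal S⊆T (mulʳ {f} p h)   = resp (embed-mulNC f h) (mulʳ (embed-ideal S⊆T p) (embed h))
embed-ideal S⊆T (resp {f} {g} f≈g p) = resp (embed-cong {f = f} {g} f≈g) (embed-ideal S⊆T p)

≈P-check : QPoly → QPoly → Bool
≈P-check []      []      = true
≈P-check []      (b ∷ r) = ⌊ 0ℚ ℚP.≟ b ⌋ ∧ ≈P-check [] r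
≈P-check (a ∷ p) []      = ⌊ a ℚP.≟ 0ℚ ⌋ ∧ ≈P-check p []
≈P-check (a ∷ p) (b ∷ r) = ⌊ a ℚP.≟ b ⌋ ∧ ≈P-check p r

≟∧-sound : ∀ {a b rest} → T (⌊ a ℚP.≟ b ⌋ ∧ rest) → a ≡ b × T rest
≟∧-sound {a} {b} t with Equivalence.to (T-∧ {⌊ a ℚP.≟ b ⌋}) t
... | a≟b , rest = toWitness {a? = a ℚP.≟ b} a≟b , rest

≈P-check-sound : ∀ p r → T (≈P-check p r) → p ≈P r
≈P-check-sound []      []      _ n       = refl
≈P-check-sound []      (b ∷ r) t zero    = proj₁ (≟∧-sound t)
≈P-check-sound []      (b ∷ r) t (suc n) = ≈P-check-sound [] r (proj₂ (≟∧-sound t)) n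
≈P-check-sound (a ∷ p) []      t zero    = proj₁ (≟∧-sound t)
≈P-check-sound (a ∷ p) []      t (suc n) = ≈P-check-sound p [] (proj₂ (≟∧-sound {a} t)) n
≈P-check-sound (a ∷ p) (b ∷ r) t zero    = proj₁ (≟∧-sound t)
≈P-check-sound (a ∷ p) (b ∷ r) t (suc n) = ≈P-check-sound p r (proj₂ (≟∧-sound {a} {b} t)) n

≈F-check : ℚ⟮q⟯ → ℚ⟮q⟯ → Bool
≈F-check x y = ≈P-check (num x *P den y) (num y *P den x)

≈F-check-sound : ∀ x y → T (≈F-check x y) → x ≈F y
≈F-check-sound x y = ≈P-check-sound (num x *P den y) (num y *P den x)

-- ℚ⟮q⟯ carries no ring laws, so an identity between coefficients is
-- established by evaluating both sides once it is known which terms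
-- contribute to the coefficient.
coeff-≈F-by-evaluation :
  ∀ {N w bs bs′} {F G : 𝒰q N} → Matches ℚ⟮q⟯ʳ w bs F → Matches ℚ⟮q⟯ʳ w bs′ G →
  T (≈F-check (selectedCoeff ℚ⟮q⟯ʳ bs F) (selectedCoeff ℚ⟮q⟯ʳ bs′ G)) →
  coeff ℚ⟮q⟯ʳ F w ≈F coeff ℚ⟮q⟯ʳ G w
coeff-≈F-by-evaluation {bs = bs} {bs′} {F} {G} F-matches G-matches t =
  subst₂ _≈F_ (sym (coeff-matches ℚ⟮q⟯ʳ F-matches)) (sym (coeff-matches ℚ⟮q⟯ʳ G-matches))
         (≈F-check-sound (selectedCoeff ℚ⟮q⟯ʳ bs F) (selectedCoeff ℚ⟮q⟯ʳ bs′ G) t)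

module _ {N : ℕ} {P : Set} where

  word-cases₂ : ∀ (x y : Word N) → x ≢ y → ∀ w →
                (x ≡ w → y ≢ w → P) → (x ≢ w → y ≡ w → P) → (x ≢ w → y ≢ w → P) → P
  word-cases₂ x y x≢y w at-x at-y elsewhere with ≡-dec FinP._≟_ x w | ≡-dec FinP._≟_ y w
  ... | yes x≡w | _       = at-x x≡w (x≢y ∘ trans x≡w ∘ sym)
  ... | no  x≢w | yes y≡w = at-y x≢w y≡w
  ... | no  x≢w | no  y≢w = elsewhere x≢w y≢w

  word-cases₃ : ∀ (x y z : Word N) → x ≢ y → x ≢ z → y ≢ z → ∀ w →
                (x ≡ w → y ≢ w → z ≢ w → P) → (x ≢ w → y ≡ w → z ≢ w → P) →
                (x ≢ w → y ≢ w → z ≡ w → P) → (x ≢ w → y ≢ w → z ≢ w → P) → P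
  word-cases₃ x y z x≢y x≢z y≢z w at-x at-y at-z elsewhere
    with ≡-dec FinP._≟_ x w | ≡-dec FinP._≟_ y w | ≡-dec FinP._≟_ z w
  ... | yes x≡w | _       | _       = at-x x≡w (x≢y ∘ trans x≡w ∘ sym) (x≢z ∘ trans x≡w ∘ sym)
  ... | no  x≢w | yes y≡w | _       = at-y x≢w y≡w (y≢z ∘ trans y≡w ∘ sym)
  ... | no  x≢w | no  y≢w | yes z≡w = at-z x≢w y≢w z≡w
  ... | no  x≢w | no  y≢w | no  z≢w = elsewhere x≢w y≢w z≢w

≢-head : ∀ {A : Set} {x y : A} {xs ys} → x ≢ y → x ∷ xs ≢ y ∷ ys
≢-head x≢y = x≢y ∘ ∷-injectiveˡ

≢-second : ∀ {A : Set} {x y u v : A} {xs ys} → x ≢ y → u ∷ x ∷ xs ≢ v ∷ y ∷ ys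
≢-second x≢y = x≢y ∘ ∷-injectiveˡ ∘ ∷-injectiveʳ

near-side-conditions : ∀ {a b c k} → a < b → b < c → c ≤ a ℕ.+ k → b < a ℕ.+ k × c < b ℕ.+ k
near-side-conditions {k = k} a<b b<c c≤a+k =
  ℕP.<-≤-trans b<c c≤a+k , ℕP.≤-<-trans c≤a+k (ℕP.+-monoˡ-< k a<b)

_−ʷ_ : ∀ {N} → Word N → Word N → 𝒰 N
x −ʷ y = subNC ℤʳ (wordNC ℤʳ x) (wordNC ℤʳ y)

module _ {N k : ℕ} (a b c : Fin N) (a<b : toℕ a < toℕ b) (b<c : toℕ b < toℕ c) where

  private
    a≢b : a ≢ b
    a≢b = FinP.<⇒≢ a<b
    b≢c : b ≢ c
    b≢c = FinP.<⇒≢ b<c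
    a≢c : a ≢ c
    a≢c = FinP.<⇒≢ (ℕP.<-trans a<b b<c)

  bac−bca∈J-Lam : toℕ a ℕ.+ k < toℕ c → J-Lam N k (embed ((b ∷ a ∷ c ∷ []) −ʷ (b ∷ c ∷ a ∷ [])))
  bac−bca∈J-Lam a+k<c =
    resp (λ w → word-cases₂ (b ∷ a ∷ c ∷ []) (b ∷ c ∷ a ∷ []) (≢-second a≢c) w
           (λ x≡w y≢w → coeff-≈F-by-evaluation (ofʸ x≡w ∷ ofⁿ y≢w ∷ []) (ofʸ x≡w ∷ ofⁿ y≢w ∷ []) tt)
           (λ x≢w y≡w → coeff-≈F-by-evaluation (ofⁿ x≢w ∷ ofʸ y≡w ∷ []) (ofⁿ x≢w ∷ ofʸ y≡w ∷ []) tt)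
           (λ x≢w y≢w → coeff-≈F-by-evaluation (ofⁿ x≢w ∷ ofⁿ y≢w ∷ []) (ofⁿ x≢w ∷ ofⁿ y≢w ∷ []) tt))
         (mulˡ [ (1F , [ b ]) ] (gen (far a c a+k<c)))

  acb−cab∈J-Lam : toℕ a ℕ.+ k < toℕ c → J-Lam N k (embed ((a ∷ c ∷ b ∷ []) −ʷ (c ∷ a ∷ b ∷ [])))
  acb−cab∈J-Lam a+k<c =
    resp (λ w → word-cases₂ (a ∷ c ∷ b ∷ []) (c ∷ a ∷ b ∷ []) (≢-head a≢c) w
           (λ x≡w y≢w → coeff-≈F-by-evaluation (ofʸ x≡w ∷ ofⁿ y≢w ∷ []) (ofʸ x≡w ∷ ofⁿ y≢w ∷ []) tt)
           (λ x≢w y≡w → coeff-≈F-by-evaluation (ofⁿ x≢w ∷ ofʸ y≡w ∷ []) (ofⁿ x≢w ∷ ofʸ y≡w ∷ []) tt)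
           (λ x≢w y≢w → coeff-≈F-by-evaluation (ofⁿ x≢w ∷ ofⁿ y≢w ∷ []) (ofⁿ x≢w ∷ ofⁿ y≢w ∷ []) tt))
         (mulʳ (gen (far a c a+k<c)) [ (1F , [ b ]) ])

  -- The combination below has terms abc, bac, abc, acb (in this order).
  bac−acb∈J-Lam : toℕ c ≤ toℕ a ℕ.+ k → J-Lam N k (embed ((b ∷ a ∷ c ∷ []) −ʷ (a ∷ c ∷ b ∷ [])))
  bac−acb∈J-Lam c≤a+k =
    resp (λ w → word-cases₃ (a ∷ b ∷ c ∷ []) (b ∷ a ∷ c ∷ []) (a ∷ c ∷ b ∷ [])
                            (≢-head a≢b) (≢-second b≢c) (≢-head (a≢b ∘ sym)) w
           (λ x≡w y≢w z≢w → coeff-≈F-by-evaluation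
              (ofʸ x≡w ∷ ofⁿ y≢w ∷ ofʸ x≡w ∷ ofⁿ z≢w ∷ []) (ofⁿ y≢w ∷ ofⁿ z≢w ∷ []) tt)
           (λ x≢w y≡w z≢w → coeff-≈F-by-evaluation
              (ofⁿ x≢w ∷ ofʸ y≡w ∷ ofⁿ x≢w ∷ ofⁿ z≢w ∷ []) (ofʸ y≡w ∷ ofⁿ z≢w ∷ []) tt)
           (λ x≢w y≢w z≡w → coeff-≈F-by-evaluation
              (ofⁿ x≢w ∷ ofⁿ y≢w ∷ ofⁿ x≢w ∷ ofʸ z≡w ∷ []) (ofⁿ y≢w ∷ ofʸ z≡w ∷ []) tt)
           (λ x≢w y≢w z≢w → coeff-≈F-by-evaluation
              (ofⁿ x≢w ∷ ofⁿ y≢w ∷ ofⁿ x≢w ∷ ofⁿ z≢w ∷ []) (ofⁿ y≢w ∷ ofⁿ z≢w ∷ []) tt))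
         (add (mulʳ (mulˡ [ (-F qF , []) ] (gen (near a b a<b b<a+k))) [ (1F , [ c ]) ])
              (mulˡ [ (qF , [ a ]) ] (gen (near b c b<c c<b+k))))
    where
    b<a+k : toℕ b < toℕ a ℕ.+ k
    b<a+k = proj₁ (near-side-conditions a<b b<c c≤a+k)
    c<b+k : toℕ c < toℕ b ℕ.+ k
    c<b+k = proj₂ (near-side-conditions a<b b<c c≤a+k)

  -- The combination below has terms bca, cba, cab, cba (in this order).
  bca−cab∈J-Lam : toℕ c ≤ toℕ a ℕ.+ k → J-Lam N k (embed ((b ∷ c ∷ a ∷ []) −ʷ (c ∷ a ∷ b ∷ [])))
  bca−cab∈J-Lam c≤a+k =
    resp (λ w → word-cases₃ (b ∷ c ∷ a ∷ []) (c ∷ b ∷ a ∷ []) (c ∷ a ∷ b ∷ [])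
                            (≢-head b≢c) (≢-head b≢c) (≢-second (a≢b ∘ sym)) w
           (λ x≡w y≢w z≢w → coeff-≈F-by-evaluation
              (ofʸ x≡w ∷ ofⁿ y≢w ∷ ofⁿ z≢w ∷ ofⁿ y≢w ∷ []) (ofʸ x≡w ∷ ofⁿ z≢w ∷ []) tt)
           (λ x≢w y≡w z≢w → coeff-≈F-by-evaluation
              (ofⁿ x≢w ∷ ofʸ y≡w ∷ ofⁿ z≢w ∷ ofʸ y≡w ∷ []) (ofⁿ x≢w ∷ ofⁿ z≢w ∷ []) tt)
           (λ x≢w y≢w z≡w → coeff-≈F-by-evaluation
              (ofⁿ x≢w ∷ ofⁿ y≢w ∷ ofʸ z≡w ∷ ofⁿ y≢w ∷ []) (ofⁿ x≢w ∷ ofʸ z≡w ∷ []) tt)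
           (λ x≢w y≢w z≢w → coeff-≈F-by-evaluation
              (ofⁿ x≢w ∷ ofⁿ y≢w ∷ ofⁿ z≢w ∷ ofⁿ y≢w ∷ []) (ofⁿ x≢w ∷ ofⁿ z≢w ∷ []) tt))
         (add (mulʳ (gen (near b c b<c c<b+k)) [ (1F , [ a ]) ])
              (mulˡ [ (-F 1F , [ c ]) ] (gen (near a b a<b b<a+k))))
    where
    b<a+k : toℕ b < toℕ a ℕ.+ k
    b<a+k = proj₁ (near-side-conditions a<b b<c c≤a+k)
    c<b+k : toℕ c < toℕ b ℕ.+ k
    c<b+k = proj₂ (near-side-conditions a<b b<c c≤a+k)

assafGen⊆J-Lam : ∀ {N k f} → AssafGen N k f → J-Lam N k (embed f)
assafGen⊆J-Lam (far₁  a b c a<b b<c a+k<c) = bac−bca∈J-Lam a b c a<b b<c a+k<c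
assafGen⊆J-Lam (far₂  a b c a<b b<c a+k<c) = acb−cab∈J-Lam a b c a<b b<c a+k<c
assafGen⊆J-Lam (near₁ a b c a<b b<c c≤a+k) = bac−acb∈J-Lam a b c a<b b<c c≤a+k
assafGen⊆J-Lam (near₂ a b c a<b b<c c≤a+k) = bca−cab∈J-Lam a b c a<b b<c c≤a+k
assafGen⊆J-Lam (rep w repeated)             = gen (rep w repeated)

proposition5p7 : (N k : ℕ) (f : 𝒰 N) → I-Assaf N k f → I-Lam N k f
proposition5p7 N k f = embed-ideal assafGen⊆J-Lam
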